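{- Let $\alpha\in\mathbb Z\setminus\{0,1\}$ and let $(h_n)$ be the sequence with $h_0=0$, $h_1=1$, $h_2=-\alpha^3(\alpha-1)(2\alpha-1)$, $h_3=-\alpha^8(\alpha-1)^3(2\alpha-1)^3$, $h_4=\alpha^{14}(\alpha-1)^6(2\alpha-1)^6$, and for $m\ge2$: $h_{2m+1}=h_{m+2}h_m^3-h_{m-1}h_{m+1}^3$, for $m\ge 3$: $h_{2m}=h_m\big(h_{m+2}h_{m-1}^2-h_{m-2}h_{m+1}^2\big)/h_2$. (i) If $n\equiv 1,7,17,23\pmod{24}$, then $h_n$ is a cube. (ii) If $n\equiv 3,4,20,21\pmod{24}$, then $h_n$ is a cube if and only if $\alpha$ is a cube. (iii) If $n\equiv 6,18\pmod{24}$, then $h_n$ is a cube if and only if $2\alpha-1$ is a cube. (iv) If $n\equiv 9,15\pmod{24}$, then $h_n$ is a cube if and only if $\alpha-1$ is a cube.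
   Context: The sequence defined is the elliptic divisibility sequence attached to the point $(0,0)$ of order $8$ on the curve $y^2+(\alpha-\xi)xy-\alpha^3\xi y=x^3-\alpha^2\xi x^2$ with $\xi=(2\alpha-1)(\alpha-1)$. Convention: an integer $m$ is called a cube if $m=\beta^3$ for some nonzero integer $\beta$. -}

module Defs where

open import Data.Nat as ℕ using (ℕ; zero; suc; _%_; ⌊_/2⌋; _∸_; _≡ᵇ_)
open import Data.Integer using (ℤ; +_; -[1+_]; _+_; _-_; _*_; -_; _^_; _/_)
open import Data.Bool using (if_then_else_)
open import Data.Product using (∃; _×_)
open import Relation.Binary.PropositionalEquality using (_≡_; _≢_)

-- Total integer division: quotient by a nonzero divisor (stdlib `_/_`),
-- and 0 for divisor 0 (never used: h₂ ≠ 0 when α ∉ {0,1}).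
divℤ : ℤ → ℤ → ℤ
divℤ a (+ zero)   = + 0
divℤ a (+ suc n)  = a / (+ suc n)
divℤ a -[1+ n ]   = a / -[1+ n ]

h₂ : ℤ → ℤ
h₂ α = - (α ^ 3 * (α - + 1) * (+ 2 * α - + 1))

-- Fuel-indexed computation of h_n (fuel ≥ n+1 suffices since every
-- recursive call has a strictly smaller index).
hF : ℤ → ℕ → ℕ → ℤ
hF α zero    n = + 0
hF α (suc k) 0 = + 0
hF α (suc k) 1 = + 1
hF α (suc k) 2 = h₂ α
hF α (suc k) 3 = - (α ^ 8 * (α - + 1) ^ 3 * (+ 2 * α - + 1) ^ 3)
hF α (suc k) 4 = α ^ 14 * (α - + 1) ^ 6 * (+ 2 * α - + 1) ^ 6
hF α (suc k) n@(suc (suc (suc (suc (suc j))))) =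
  if (n % 2) ≡ᵇ 0
  then divℤ (H m * (H (m ℕ.+ 2) * H (m ∸ 1) ^ 2 - H (m ∸ 2) * H (m ℕ.+ 1) ^ 2)) (h₂ α)
  else H (m ℕ.+ 2) * H m ^ 3 - H (m ∸ 1) * H (m ℕ.+ 1) ^ 3
  where
    m = ⌊ n /2⌋
    H = hF α k

h : ℤ → ℕ → ℤ
h α n = hF α (suc n) n

IsCube : ℤ → Set
IsCube m = ∃ λ (β : ℤ) → (β ≢ + 0) × (m ≡ β * β * β)

module Submission where

-- The proof computes h in closed form.  Each h_n is 0 (when 8 ∣ n) or a
-- signed monomial ±αᵃ(α−1)ᵇ(2α−1)ᶜ, and h is quasi-periodic:
-- h_{n+8} = h_n · μ_n with μ_n = −w^{n+4}, w = −α¹⁵(α−1)⁷(2α−1)⁶.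
--   * Both recurrences defining h have the same total weight on each side,
--     so for any quasi-periodic sequence they propagate from m to m + 8.
--     For the closed form this leaves sixteen base cases, each a monomial
--     computation followed, where needed, by 2α−1 − α = α−1 or
--     α² − (2α−1) = (α−1)²; as h is determined by its recurrences and
--     initial values, h equals the closed form.
--   * Over three quasi-periods the multiplier is a cube,
--     h_{n+24} = h_n · μ_{n+8}³, so whether h_n is a cube depends on n mod 24.
--   * For the residues of the theorem the closed form is a nonzero cube times
--     1, α², 2α−1 or (α−1)², and t·β³ (β ≠ 0), resp. t², is a cube iff t is.

open import Defs
open import Data.Nat as ℕ using (ℕ; zero; suc; _%_; ⌊_/2⌋)
open import Data.Integer using (ℤ; +_; -[1+_]; -_; _+_; _-_; _*_; _^_; ∣_∣; sign; _◃_)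
import Data.Integer as ℤ
import Data.Nat.Properties as ℕP
import Data.Integer.Properties as ℤP
open import Data.Nat.Divisibility using (_∣_; divides; ∣-trans; ∣1⇒≡1; m∣m*n; *-cancelʳ-∣)
import Data.Nat.DivMod as ℕD
open import Data.Nat.GCD using (gcd; gcd[m,n]∣m; gcd[m,n]∣n; gcd[m,n]≢0)
open import Data.Nat.Coprimality using (Coprime; coprime-/gcd; coprime-divisor)
open import Data.Integer.DivMod using (a≡a%n+[a/n]*n; n%d<d)
open import Data.Integer.Tactic.RingSolver using () renaming (solve-∀ to ℤ-solve)
open import Data.Nat.Tactic.RingSolver using () renaming (solve-∀ to ℕ-solve)
open import Data.Product using (_×_; _,_)
open import Data.Bool using (Bool; true; false; not; _xor_)
open import Data.List using (List; []; _∷_; _++_; replicate)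
open import Data.Maybe using (Maybe; just; nothing; fromMaybe)
open import Data.Sum using (_⊎_; inj₁; inj₂)
open import Data.Empty using (⊥-elim)
open import Function.Bundles using (_⇔_; mk⇔; Equivalence)
open import Function.Construct.Composition using (_⇔-∘_)
open import Function.Construct.Identity using (⇔-id)
open import Function using (_∘_)
open import Relation.Binary.PropositionalEquality
import Data.Sign as 𝕊
open import Algebra.Properties.CommutativeSemigroup ℤP.*-commutativeSemigroup using (interchange)

-- Exact division: the remainder of x·d by d is a multiple (x − q)·d of d
-- smaller than |d|, so it vanishes and the quotient q is x.
*-/-exact : ∀ x d .{{_ : ℤ.NonZero d}} → (x * d) ℤ./ d ≡ x
*-/-exact x d = sym (ℤP.i-j≡0⇒i≡j x q (ℤP.∣i∣≡0⇒i≡0 (ℕP.n<1⇒n≡0 ∣x-q∣<1)))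
  where
  q = (x * d) ℤ./ d
  r = (x * d) ℤ.% d
  remainder : (x - q) * d ≡ + r
  remainder = begin
    (x - q) * d           ≡⟨ distrib x q d ⟩
    x * d - q * d         ≡⟨ cong (_- q * d) (a≡a%n+[a/n]*n (x * d) d) ⟩
    + r + q * d - q * d   ≡⟨ cancel (+ r) (q * d) ⟩
    + r                   ∎
    where
    open ≡-Reasoning
    distrib : ∀ x q d → (x - q) * d ≡ x * d - q * d
    distrib = ℤ-solve
    cancel : ∀ r a → r + a - a ≡ r
    cancel = ℤ-solve
  ∣x-q∣<1 : ∣ x - q ∣ ℕ.< 1
  ∣x-q∣<1 = ℕP.*-cancelʳ-< ∣ d ∣ ∣ x - q ∣ 1
    (subst (ℕ._< 1 ℕ.* ∣ d ∣) (sym (trans (sym (ℤP.abs-* (x - q) d)) (cong ∣_∣ remainder)))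
      (subst (r ℕ.<_) (sym (ℕP.*-identityˡ ∣ d ∣)) (n%d<d (x * d) d)))

divℤ-exact : ∀ x d → d ≢ + 0 → divℤ (x * d) d ≡ x
divℤ-exact x (+ zero)  d≢0 = ⊥-elim (d≢0 refl)
divℤ-exact x (+ suc n) _   = *-/-exact x (+ suc n)
divℤ-exact x -[1+ n ]  _   = *-/-exact x -[1+ n ]

*-≢0 : ∀ {i j} → i ≢ + 0 → j ≢ + 0 → i * j ≢ + 0
*-≢0 {i} i≢0 j≢0 ij≡0 with ℤP.i*j≡0⇒i≡0∨j≡0 i ij≡0
... | inj₁ i≡0 = i≢0 i≡0
... | inj₂ j≡0 = j≢0 j≡0

flip-sides : ∀ a b {c} → a - b ≡ c → b - a ≡ - c
flip-sides a b a-b≡c = trans (negated a b) (cong -_ a-b≡c)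
  where
  negated : ∀ a b → b - a ≡ - (a - b)
  negated = ℤ-solve

^-distribʳ-*ℤ : ∀ x y n → (x * y) ^ n ≡ x ^ n * y ^ n
^-distribʳ-*ℤ x y zero    = refl
^-distribʳ-*ℤ x y (suc n) = trans (cong (x * y *_) (^-distribʳ-*ℤ x y n)) (interchange x y (x ^ n) (y ^ n))

^-distribʳ-*ℕ : ∀ m n k → (m ℕ.* n) ℕ.^ k ≡ m ℕ.^ k ℕ.* n ℕ.^ k
^-distribʳ-*ℕ m n zero    = refl
^-distribʳ-*ℕ m n (suc k) = trans (cong (m ℕ.* n ℕ.*_) (^-distribʳ-*ℕ m n k)) (swap m n (m ℕ.^ k) (n ℕ.^ k))
  where
  swap : ∀ a b x y → a ℕ.* b ℕ.* (x ℕ.* y) ≡ a ℕ.* x ℕ.* (b ℕ.* y)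
  swap = ℕ-solve

coprime-∣-^ : ∀ {m n} k → Coprime m n → m ∣ n ℕ.^ k → m ∣ 1
coprime-∣-^ zero    _   m∣1  = m∣1
coprime-∣-^ (suc k) cop m∣nn = coprime-∣-^ k cop (coprime-divisor cop m∣nn)

-- Powers detect divisibility: bᵏ⁺¹ ∣ gᵏ⁺¹ implies b ∣ g.  Writing b = b'·d and
-- g = g'·d with d = gcd(b, g), coprimality of b' and g' forces b' = 1.
^-cancel-∣ : ∀ k b g .{{_ : ℕ.NonZero b}} → b ℕ.^ suc k ∣ g ℕ.^ suc k → b ∣ g
^-cancel-∣ k b g bᵏ∣gᵏ = subst (_∣ g) d≡b (gcd[m,n]∣n b g)
  where
  d = gcd b g
  instance
    d≢0 : ℕ.NonZero d
    d≢0 = ℕ.≢-nonZero (gcd[m,n]≢0 b g (inj₁ (ℕ.≢-nonZero⁻¹ b)))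
    dᵏ≢0 : ℕ.NonZero (d ℕ.^ suc k)
    dᵏ≢0 = ℕP.m^n≢0 d (suc k)
  b' = b ℕ./ d
  g' = g ℕ./ d
  powers : b' ℕ.^ suc k ℕ.* d ℕ.^ suc k ∣ g' ℕ.^ suc k ℕ.* d ℕ.^ suc k
  powers = subst₂ _∣_ (split b (gcd[m,n]∣m b g)) (split g (gcd[m,n]∣n b g)) bᵏ∣gᵏ
    where
    split : ∀ x → d ∣ x → x ℕ.^ suc k ≡ (x ℕ./ d) ℕ.^ suc k ℕ.* d ℕ.^ suc k
    split x d∣x = trans (cong (ℕ._^ suc k) (sym (ℕD.m/n*n≡m d∣x))) (^-distribʳ-*ℕ (x ℕ./ d) d (suc k))
  b'∣1 : b' ∣ 1
  b'∣1 = coprime-∣-^ (suc k) (coprime-/gcd b g)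
           (∣-trans (m∣m*n (b' ℕ.^ k)) (*-cancelʳ-∣ (d ℕ.^ suc k) powers))
  d≡b : d ≡ b
  d≡b = trans (sym (ℕP.*-identityˡ d)) (trans (cong (ℕ._* d) (sym (∣1⇒≡1 b'∣1))) (ℕD.m/n*n≡m (gcd[m,n]∣m b g)))

-- An integer is determined by its sign and absolute value, and ◃ is
-- multiplicative, so sign t ◃ q³ is the cube of sign t ◃ q.
◃-cube : ∀ s q → s ◃ (q ℕ.* q ℕ.* q) ≡ (s ◃ q) * (s ◃ q) * (s ◃ q)
◃-cube s q = begin
  s ◃ (q ℕ.* q ℕ.* q)                    ≡⟨ cong (_◃ (q ℕ.* q ℕ.* q)) (sign-cube s) ⟩
  (s 𝕊.* s 𝕊.* s) ◃ (q ℕ.* q ℕ.* q)      ≡⟨ ℤP.◃-distrib-* (s 𝕊.* s) s (q ℕ.* q) q ⟩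
  ((s 𝕊.* s) ◃ (q ℕ.* q)) * (s ◃ q)       ≡⟨ cong (_* (s ◃ q)) (ℤP.◃-distrib-* s s q q) ⟩
  (s ◃ q) * (s ◃ q) * (s ◃ q)            ∎
  where
  open ≡-Reasoning
  sign-cube : ∀ s → s ≡ s 𝕊.* s 𝕊.* s
  sign-cube 𝕊.- = refl
  sign-cube 𝕊.+ = refl

-- If t·b³ = g³ with b, g ≠ 0 then t is a cube: on absolute values
-- |b|³ ∣ |g|³, so |g| = q·|b| and |t| = q³.
cube-cofactor : ∀ t b g → b ≢ + 0 → g ≢ + 0 → t * (b * b * b) ≡ g * g * g → IsCube t
cube-cofactor t b g b≢0 g≢0 eq = root (^-cancel-∣ 2 ∣ b ∣ ∣ g ∣ (divides ∣ t ∣ abs-cubes))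
  where
  instance
    ∣b∣≢0 : ℕ.NonZero ∣ b ∣
    ∣b∣≢0 = ℕ.≢-nonZero (b≢0 ∘ ℤP.∣i∣≡0⇒i≡0)
  abs-cube : ∀ x → ∣ x * x * x ∣ ≡ ∣ x ∣ ℕ.* ∣ x ∣ ℕ.* ∣ x ∣
  abs-cube x = trans (ℤP.abs-* (x * x) x) (cong (ℕ._* ∣ x ∣) (ℤP.abs-* x x))
  cube≡^3 : ∀ n → n ℕ.* n ℕ.* n ≡ n ℕ.* (n ℕ.* (n ℕ.* 1))
  cube≡^3 = ℕ-solve
  abs-eq : ∣ t ∣ ℕ.* (∣ b ∣ ℕ.* ∣ b ∣ ℕ.* ∣ b ∣) ≡ ∣ g ∣ ℕ.* ∣ g ∣ ℕ.* ∣ g ∣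
  abs-eq = trans (sym (trans (ℤP.abs-* t (b * b * b)) (cong (∣ t ∣ ℕ.*_) (abs-cube b))))
                 (trans (cong ∣_∣ eq) (abs-cube g))
  abs-cubes : ∣ g ∣ ℕ.^ 3 ≡ ∣ t ∣ ℕ.* ∣ b ∣ ℕ.^ 3
  abs-cubes = trans (sym (cube≡^3 ∣ g ∣)) (trans (sym abs-eq) (cong (∣ t ∣ ℕ.*_) (cube≡^3 ∣ b ∣)))
  root : ∣ b ∣ ∣ ∣ g ∣ → IsCube t
  root (divides q ∣g∣≡q∣b∣) = sign t ◃ q , β≢0 , t≡β³
    where
    instance
      ∣b∣³≢0 : ℕ.NonZero (∣ b ∣ ℕ.* ∣ b ∣ ℕ.* ∣ b ∣)
      ∣b∣³≢0 = ℕP.m*n≢0 (∣ b ∣ ℕ.* ∣ b ∣) ∣ b ∣ {{ℕP.m*n≢0 ∣ b ∣ ∣ b ∣}}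
    expand : ∀ q x → (q ℕ.* x) ℕ.* (q ℕ.* x) ℕ.* (q ℕ.* x) ≡ (q ℕ.* q ℕ.* q) ℕ.* (x ℕ.* x ℕ.* x)
    expand = ℕ-solve
    ∣t∣≡q³ : ∣ t ∣ ≡ q ℕ.* q ℕ.* q
    ∣t∣≡q³ = ℕP.*-cancelʳ-≡ ∣ t ∣ (q ℕ.* q ℕ.* q) (∣ b ∣ ℕ.* ∣ b ∣ ℕ.* ∣ b ∣)
      (trans abs-eq (trans (cong (λ x → x ℕ.* x ℕ.* x) ∣g∣≡q∣b∣) (expand q ∣ b ∣)))
    β≢0 : sign t ◃ q ≢ + 0
    β≢0 β≡0 = g≢0 (ℤP.∣i∣≡0⇒i≡0 (trans ∣g∣≡q∣b∣ (cong (ℕ._* ∣ b ∣) q≡0)))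
      where
      q≡0 : q ≡ 0
      q≡0 = trans (sym (ℤP.abs-◃ (sign t) q)) (cong ∣_∣ β≡0)
    t≡β³ : t ≡ (sign t ◃ q) * (sign t ◃ q) * (sign t ◃ q)
    t≡β³ = trans (sym (ℤP.◃-inverse t)) (trans (cong (sign t ◃_) ∣t∣≡q³) (◃-cube (sign t) q))

cube≢0 : ∀ {γ} → γ ≢ + 0 → γ * γ * γ ≢ + 0
cube≢0 {γ} γ≢0 γ³≡0 = γ≢0 (ℤP.i^n≡0⇒i≡0 γ 3 (trans (cube≡^3 γ) γ³≡0))
  where
  cube≡^3 : ∀ x → x * (x * (x * + 1)) ≡ x * x * x
  cube≡^3 = ℤ-solve

IsCube-one : IsCube (+ 1)
IsCube-one = + 1 , (λ ()) , refl

IsCube-scale : ∀ {t} β → β ≢ + 0 → IsCube (t * (β * β * β)) ⇔ IsCube t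
IsCube-scale {t} β β≢0 = mk⇔ to from
  where
  to : IsCube (t * (β * β * β)) → IsCube t
  to (γ , γ≢0 , eq) = cube-cofactor t β γ β≢0 γ≢0 eq
  regroup : ∀ δ β → δ * δ * δ * (β * β * β) ≡ (δ * β) * (δ * β) * (δ * β)
  regroup = ℤ-solve
  from : IsCube t → IsCube (t * (β * β * β))
  from (δ , δ≢0 , refl) = δ * β , *-≢0 δ≢0 β≢0 , regroup δ β

-- A square t² is a cube exactly when t is: if t² = γ³ then t·t³ = (γ²)³.
IsCube-square : ∀ {t} → IsCube (t * t) ⇔ IsCube t
IsCube-square {t} = mk⇔ to from
  where
  cube-squared : ∀ γ → (γ * γ * γ) * (γ * γ * γ) ≡ (γ * γ) * (γ * γ) * (γ * γ)
  cube-squared = ℤ-solve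
  fourth-power : ∀ t → t * (t * t * t) ≡ (t * t) * (t * t)
  fourth-power = ℤ-solve
  to : IsCube (t * t) → IsCube t
  to (γ , γ≢0 , t²≡γ³) = cube-cofactor t t (γ * γ) t≢0 (*-≢0 γ≢0 γ≢0)
    (trans (fourth-power t) (trans (cong (λ x → x * x) t²≡γ³) (cube-squared γ)))
    where
    t≢0 : t ≢ + 0
    t≢0 refl = cube≢0 γ≢0 (sym t²≡γ³)
  from : IsCube t → IsCube (t * t)
  from (δ , δ≢0 , refl) = δ * δ , *-≢0 δ≢0 δ≢0 , cube-squared δ

oddTerm : (ℕ → ℤ) → ℕ → ℤ
oddTerm f m = f (m ℕ.+ 2) * f m ^ 3 - f (m ℕ.∸ 1) * f (m ℕ.+ 1) ^ 3

evenTerm : (ℕ → ℤ) → ℕ → ℤ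
evenTerm f m = f m * (f (m ℕ.+ 2) * f (m ℕ.∸ 1) ^ 2 - f (m ℕ.∸ 2) * f (m ℕ.+ 1) ^ 2)

OddRel : (ℕ → ℤ) → ℕ → Set
OddRel f m = oddTerm f m ≡ f (suc (m ℕ.+ m))

EvenRel : (ℕ → ℤ) → ℕ → Set
EvenRel f m = evenTerm f m ≡ f (m ℕ.+ m) * f 2

two-more : ∀ n → suc (suc n) % 2 ≡ n % 2
two-more n = trans (cong (_% 2) (ℕP.+-comm 2 n)) (ℕD.[m+n]%n≡m%n n 2)

halves : ∀ n → (n % 2 ≡ 0 × ⌊ n /2⌋ ℕ.+ ⌊ n /2⌋ ≡ n) ⊎ (n % 2 ≡ 1 × suc (⌊ n /2⌋ ℕ.+ ⌊ n /2⌋) ≡ n)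
halves 0 = inj₁ (refl , refl)
halves 1 = inj₂ (refl , refl)
halves (suc (suc n)) with halves n
... | inj₁ (even , n≡m+m) = inj₁ (trans (two-more n) even , trans (ℕP.+-suc (suc m) m) (cong (suc ∘ suc) n≡m+m))
  where m = ⌊ n /2⌋
... | inj₂ (odd , n≡1+m+m) = inj₂ (trans (two-more n) odd , trans (cong suc (ℕP.+-suc (suc m) m)) (cong (suc ∘ suc) n≡1+m+m))
  where m = ⌊ n /2⌋

oddTerm-cong : ∀ {g f} m → (∀ i → i ℕ.≤ m ℕ.+ 2 → g i ≡ f i) → oddTerm g m ≡ oddTerm f m
oddTerm-cong m agree =
  cong₂ _-_ (cong₂ (λ p q → p * q ^ 3) (agree (m ℕ.+ 2) ℕP.≤-refl) (agree m (ℕP.m≤m+n m 2)))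
            (cong₂ (λ p q → p * q ^ 3) (agree (m ℕ.∸ 1) (below-∸ 1)) (agree (m ℕ.+ 1) (ℕP.+-monoʳ-≤ m (ℕ.s≤s ℕ.z≤n))))
  where
  below-∸ : ∀ k → m ℕ.∸ k ℕ.≤ m ℕ.+ 2
  below-∸ k = ℕP.≤-trans (ℕP.m∸n≤m m k) (ℕP.m≤m+n m 2)

evenTerm-cong : ∀ {g f} m → (∀ i → i ℕ.≤ m ℕ.+ 2 → g i ≡ f i) → evenTerm g m ≡ evenTerm f m
evenTerm-cong m agree =
  cong₂ _*_ (agree m (ℕP.m≤m+n m 2))
    (cong₂ _-_ (cong₂ (λ p q → p * q ^ 2) (agree (m ℕ.+ 2) ℕP.≤-refl) (agree (m ℕ.∸ 1) (below-∸ 1)))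
               (cong₂ (λ p q → p * q ^ 2) (agree (m ℕ.∸ 2) (below-∸ 2)) (agree (m ℕ.+ 1) (ℕP.+-monoʳ-≤ m (ℕ.s≤s ℕ.z≤n)))))
  where
  below-∸ : ∀ k → m ℕ.∸ k ℕ.≤ m ℕ.+ 2
  below-∸ k = ℕP.≤-trans (ℕP.m∸n≤m m k) (ℕP.m≤m+n m 2)

even-half-≥3 : ∀ m → 5 ℕ.≤ m ℕ.+ m → 3 ℕ.≤ m
even-half-≥3 (suc (suc (suc m))) _ = ℕ.s≤s (ℕ.s≤s (ℕ.s≤s ℕ.z≤n))
even-half-≥3 0 ()
even-half-≥3 1 (ℕ.s≤s (ℕ.s≤s ()))
even-half-≥3 2 (ℕ.s≤s (ℕ.s≤s (ℕ.s≤s (ℕ.s≤s ()))))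

odd-half-≥2 : ∀ m → 5 ℕ.≤ suc (m ℕ.+ m) → 2 ℕ.≤ m
odd-half-≥2 (suc (suc m)) _ = ℕ.s≤s (ℕ.s≤s ℕ.z≤n)
odd-half-≥2 0 (ℕ.s≤s ())
odd-half-≥2 1 (ℕ.s≤s (ℕ.s≤s (ℕ.s≤s ())))

-- h is the only sequence with its first five values satisfying both
-- recurrences (the odd one from m = 2, the even one from m = 3 on): the
-- definition of h unfolds to these recurrences, and every index it refers
-- to is smaller, so the two sequences agree by strong induction.
h-unique : ∀ α f → (∀ n → n ℕ.< 5 → h α n ≡ f n) → (∀ m → 2 ℕ.≤ m → OddRel f m) →
           (∀ m → 3 ℕ.≤ m → EvenRel f m) → h₂ α ≢ + 0 → ∀ n → h α n ≡ f n
h-unique α f initial odd even h₂≢0 n = agree (suc n) n ℕP.≤-refl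
  where
  agree : ∀ k n → n ℕ.< k → hF α k n ≡ f n
  agree (suc k) 0 _ = initial 0 (ℕ.s≤s ℕ.z≤n)
  agree (suc k) 1 _ = initial 1 (ℕ.s≤s (ℕ.s≤s ℕ.z≤n))
  agree (suc k) 2 _ = initial 2 (ℕ.s≤s (ℕ.s≤s (ℕ.s≤s ℕ.z≤n)))
  agree (suc k) 3 _ = initial 3 (ℕ.s≤s (ℕ.s≤s (ℕ.s≤s (ℕ.s≤s ℕ.z≤n))))
  agree (suc k) 4 _ = initial 4 (ℕ.s≤s (ℕ.s≤s (ℕ.s≤s (ℕ.s≤s (ℕ.s≤s ℕ.z≤n)))))
  agree (suc k) n@(suc (suc (suc (suc (suc j))))) (ℕ.s≤s n≤k) with halves n
  ... | inj₁ (n%2≡0 , m+m≡n) rewrite n%2≡0 = begin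
    divℤ (evenTerm (hF α k) m) (h₂ α)   ≡⟨ cong (λ x → divℤ x (h₂ α)) (evenTerm-cong m below) ⟩
    divℤ (evenTerm f m) (h₂ α)          ≡⟨ cong (λ x → divℤ x (h₂ α)) (even m 3≤m) ⟩
    divℤ (f (m ℕ.+ m) * f 2) (h₂ α)     ≡⟨ cong₂ (λ i x → divℤ (f i * x) (h₂ α)) m+m≡n (sym (initial 2 (ℕ.s≤s (ℕ.s≤s (ℕ.s≤s ℕ.z≤n))))) ⟩
    divℤ (f n * h₂ α) (h₂ α)            ≡⟨ divℤ-exact (f n) (h₂ α) h₂≢0 ⟩
    f n                                 ∎
    where
    open ≡-Reasoning
    m = ⌊ n /2⌋
    3≤m : 3 ℕ.≤ m
    3≤m = even-half-≥3 m (subst (5 ℕ.≤_) (sym m+m≡n) (ℕP.m≤m+n 5 j))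
    below : ∀ i → i ℕ.≤ m ℕ.+ 2 → hF α k i ≡ f i
    below i i≤m+2 = agree k i (ℕP.≤-trans (ℕ.s≤s i≤m+2) (ℕP.≤-trans (subst (m ℕ.+ 2 ℕ.<_) m+m≡n (ℕP.+-monoʳ-< m 3≤m)) n≤k))
  ... | inj₂ (n%2≡1 , 1+m+m≡n) rewrite n%2≡1 = begin
    oddTerm (hF α k) m    ≡⟨ oddTerm-cong m below ⟩
    oddTerm f m           ≡⟨ odd m 2≤m ⟩
    f (suc (m ℕ.+ m))     ≡⟨ cong f 1+m+m≡n ⟩
    f n                   ∎
    where
    open ≡-Reasoning
    m = ⌊ n /2⌋
    2≤m : 2 ℕ.≤ m
    2≤m = odd-half-≥2 m (subst (5 ℕ.≤_) (sym 1+m+m≡n) (ℕP.m≤m+n 5 j))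
    below : ∀ i → i ℕ.≤ m ℕ.+ 2 → hF α k i ≡ f i
    below i i≤m+2 = agree k i (ℕP.≤-trans (ℕ.s≤s i≤m+2) (ℕP.≤-trans (subst (m ℕ.+ 2 ℕ.<_) 1+m+m≡n (ℕ.s≤s (ℕP.+-monoʳ-≤ m 2≤m))) n≤k))

-- The multiplier of the quasi-period 8 (f (8 + n) = f n · mult w n for the
-- sequences considered) and the powers of w it produces.  Both are opaque:
-- only the facts below are used, which also keeps the typechecker from
-- unfolding large powers.
opaque
  mult : ℤ → ℕ → ℤ
  mult w n = - (w ^ (4 ℕ.+ n))

  mult-def : ∀ w n → mult w n ≡ - (w ^ (4 ℕ.+ n))
  mult-def w n = refl

  power : ℤ → ℕ → ℤ
  power = _^_

  power-+ : ∀ w j k → power w (j ℕ.+ k) ≡ power w j * power w k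
  power-+ = ℤP.^-distribˡ-+-*

  mult-pair : ∀ w a b → mult w a * mult w b ≡ power w (8 ℕ.+ (a ℕ.+ b))
  mult-pair w a b = begin
    - (w ^ (4 ℕ.+ a)) * - (w ^ (4 ℕ.+ b))  ≡⟨ neg-neg (w ^ (4 ℕ.+ a)) (w ^ (4 ℕ.+ b)) ⟩
    w ^ (4 ℕ.+ a) * w ^ (4 ℕ.+ b)          ≡⟨ ℤP.^-distribˡ-+-* w (4 ℕ.+ a) (4 ℕ.+ b) ⟨
    w ^ ((4 ℕ.+ a) ℕ.+ (4 ℕ.+ b))          ≡⟨ cong (w ^_) (exponent a b) ⟩
    w ^ (8 ℕ.+ (a ℕ.+ b))                  ∎
    where
    open ≡-Reasoning
    neg-neg : ∀ x y → - x * - y ≡ x * y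
    neg-neg = ℤ-solve
    exponent : ∀ a b → (4 ℕ.+ a) ℕ.+ (4 ℕ.+ b) ≡ 8 ℕ.+ (a ℕ.+ b)
    exponent = ℕ-solve

  mult-power : ∀ w a e → mult w a * power w e ≡ - power w ((4 ℕ.+ a) ℕ.+ e)
  mult-power w a e = trans (sym (ℤP.neg-distribˡ-* (w ^ (4 ℕ.+ a)) (w ^ e)))
                           (cong -_ (sym (ℤP.^-distribˡ-+-* w (4 ℕ.+ a) e)))

  mult≢0 : ∀ {w} a → w ≢ + 0 → mult w a ≢ + 0
  mult≢0 {w} a w≢0 μ≡0 = w≢0 (ℤP.i^n≡0⇒i≡0 w (4 ℕ.+ a) (ℤP.neg-injective μ≡0))

-- Multipliers of equal weight x·yⁿ factor out of a difference of the
-- shape (a·x)(b·y)ⁿ − (c·z)(d·v)ⁿ; this is how the recurrences see a shift.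
scale-odd : ∀ n a b c d x y z v K → x * y ^ n ≡ K → z * v ^ n ≡ K →
             (a * x) * (b * y) ^ n - (c * z) * (d * v) ^ n ≡ (a * b ^ n - c * d ^ n) * K
scale-odd n a b c d x y z v K xyⁿ≡K zvⁿ≡K = begin
  (a * x) * (b * y) ^ n - (c * z) * (d * v) ^ n
    ≡⟨ cong₂ _-_ (separate a b x y) (separate c d z v) ⟩
  (a * b ^ n) * (x * y ^ n) - (c * d ^ n) * (z * v ^ n)
    ≡⟨ cong₂ (λ p q → (a * b ^ n) * p - (c * d ^ n) * q) xyⁿ≡K zvⁿ≡K ⟩
  (a * b ^ n) * K - (c * d ^ n) * K
    ≡⟨ factor (a * b ^ n) (c * d ^ n) K ⟩
  (a * b ^ n - c * d ^ n) * K
    ∎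
  where
  open ≡-Reasoning
  separate : ∀ a b x y → (a * x) * (b * y) ^ n ≡ (a * b ^ n) * (x * y ^ n)
  separate a b x y = trans (cong (a * x *_) (^-distribʳ-*ℤ b y n)) (interchange a x (b ^ n) (y ^ n))
  factor : ∀ p q K → p * K - q * K ≡ (p - q) * K
  factor = ℤ-solve

scale-even : ∀ a b c d e x y z u v K → x * (y * z ^ 2) ≡ K → x * (u * v ^ 2) ≡ K →
             (a * x) * ((b * y) * (c * z) ^ 2 - (d * u) * (e * v) ^ 2) ≡ a * (b * c ^ 2 - d * e ^ 2) * K
scale-even a b c d e x y z u v K xyz²≡K xuv²≡K = begin
  (a * x) * ((b * y) * (c * z) ^ 2 - (d * u) * (e * v) ^ 2)
    ≡⟨ distrib (a * x) ((b * y) * (c * z) ^ 2) ((d * u) * (e * v) ^ 2) ⟩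
  (a * x) * ((b * y) * (c * z) ^ 2) - (a * x) * ((d * u) * (e * v) ^ 2)
    ≡⟨ cong₂ _-_ (separate b c y z) (separate d e u v) ⟩
  (a * (b * c ^ 2)) * (x * (y * z ^ 2)) - (a * (d * e ^ 2)) * (x * (u * v ^ 2))
    ≡⟨ cong₂ (λ p q → (a * (b * c ^ 2)) * p - (a * (d * e ^ 2)) * q) xyz²≡K xuv²≡K ⟩
  (a * (b * c ^ 2)) * K - (a * (d * e ^ 2)) * K
    ≡⟨ factor a (b * c ^ 2) (d * e ^ 2) K ⟩
  a * (b * c ^ 2 - d * e ^ 2) * K
    ∎
  where
  open ≡-Reasoning
  separate : ∀ b c y z → (a * x) * ((b * y) * (c * z) ^ 2) ≡ (a * (b * c ^ 2)) * (x * (y * z ^ 2))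
  separate b c y z = begin
    (a * x) * ((b * y) * (c * z) ^ 2)         ≡⟨ cong (λ p → (a * x) * ((b * y) * p)) (^-distribʳ-*ℤ c z 2) ⟩
    (a * x) * ((b * y) * (c ^ 2 * z ^ 2))     ≡⟨ cong ((a * x) *_) (interchange b y (c ^ 2) (z ^ 2)) ⟩
    (a * x) * ((b * c ^ 2) * (y * z ^ 2))     ≡⟨ interchange a x (b * c ^ 2) (y * z ^ 2) ⟩
    (a * (b * c ^ 2)) * (x * (y * z ^ 2))     ∎
  distrib : ∀ p q r → p * (q - r) ≡ p * q - p * r
  distrib = ℤ-solve
  factor : ∀ a p q K → a * p * K - a * q * K ≡ a * (p - q) * K
  factor = ℤ-solve

periodic-induction : ∀ p .{{_ : ℕ.NonZero p}} {P : ℕ → Set} →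
                     (∀ m → P m → P (p ℕ.+ m)) → (∀ r → r ℕ.< p → P r) → ∀ m → P m
periodic-induction p {P} step base m = subst P (sym (ℕD.m≡m%n+[m/n]*n m p)) (along (m ℕ./ p))
  where
  r = m % p
  along : ∀ q → P (r ℕ.+ q ℕ.* p)
  along zero    = subst P (sym (ℕP.+-identityʳ r)) (base r (ℕD.m%n<n m p))
  along (suc q) = subst P (one-more r q p) (step (r ℕ.+ q ℕ.* p) (along q))
    where
    one-more : ∀ r q p → p ℕ.+ (r ℕ.+ q ℕ.* p) ≡ r ℕ.+ suc q ℕ.* p
    one-more = ℕ-solve

-- Both recurrences have the same
-- total weight on each side, so shifting the index by 8 multiplies every
-- term by the same power of w: each relation propagates from m to 8 + m.
module QuasiPeriodic (w : ℤ) (f : ℕ → ℤ) (shift : ∀ n → f (8 ℕ.+ n) ≡ f n * mult w n) where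

  private
    μ : ℕ → ℤ
    μ = mult w

  mult-cubic : ∀ a b → μ a * μ b ^ 3 ≡ power w ((8 ℕ.+ (a ℕ.+ b)) ℕ.+ (8 ℕ.+ (b ℕ.+ b)))
  mult-cubic a b = begin
    μ a * μ b ^ 3              ≡⟨ pairs (μ a) (μ b) ⟩
    (μ a * μ b) * (μ b * μ b)  ≡⟨ cong₂ _*_ (mult-pair w a b) (mult-pair w b b) ⟩
    power w (8 ℕ.+ (a ℕ.+ b)) * power w (8 ℕ.+ (b ℕ.+ b)) ≡⟨ power-+ w (8 ℕ.+ (a ℕ.+ b)) (8 ℕ.+ (b ℕ.+ b)) ⟨
    power w ((8 ℕ.+ (a ℕ.+ b)) ℕ.+ (8 ℕ.+ (b ℕ.+ b))) ∎
    where
    open ≡-Reasoning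
    pairs : ∀ x y → x * (y * (y * (y * + 1))) ≡ (x * y) * (y * y)
    pairs = ℤ-solve

  shift² : ∀ n → f (8 ℕ.+ (8 ℕ.+ n)) ≡ f n * power w (8 ℕ.+ (n ℕ.+ (8 ℕ.+ n)))
  shift² n = begin
    f (8 ℕ.+ (8 ℕ.+ n))         ≡⟨ shift (8 ℕ.+ n) ⟩
    f (8 ℕ.+ n) * μ (8 ℕ.+ n)   ≡⟨ cong (_* μ (8 ℕ.+ n)) (shift n) ⟩
    f n * μ n * μ (8 ℕ.+ n)     ≡⟨ ℤP.*-assoc (f n) (μ n) (μ (8 ℕ.+ n)) ⟩
    f n * (μ n * μ (8 ℕ.+ n))   ≡⟨ cong (f n *_) (mult-pair w n (8 ℕ.+ n)) ⟩
    f n * power w (8 ℕ.+ (n ℕ.+ (8 ℕ.+ n))) ∎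
    where open ≡-Reasoning

  -- The odd relation at 8 + m is the one at m times a common power of w;
  -- m ≥ 1 so that the index m ∸ 1 shifts along.
  odd-shift : ∀ m → OddRel f (suc m) → OddRel f (8 ℕ.+ suc m)
  odd-shift m rel = begin
    oddTerm f (8 ℕ.+ M)
      ≡⟨ cong₂ _-_ (cong₂ (λ p q → p * q ^ 3) (shift (M ℕ.+ 2)) (shift M))
                   (cong₂ (λ p q → p * q ^ 3) (shift m) (shift (M ℕ.+ 1))) ⟩
    (f (M ℕ.+ 2) * μ (M ℕ.+ 2)) * (f M * μ M) ^ 3 - (f m * μ m) * (f (M ℕ.+ 1) * μ (M ℕ.+ 1)) ^ 3
      ≡⟨ scale-odd 3 (f (M ℕ.+ 2)) (f M) (f m) (f (M ℕ.+ 1)) (μ (M ℕ.+ 2)) (μ M) (μ m) (μ (M ℕ.+ 1)) (power w E)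
           (trans (mult-cubic (M ℕ.+ 2) M) (cong (power w) (weight₁ m)))
           (trans (mult-cubic m (M ℕ.+ 1)) (cong (power w) (weight₂ m))) ⟩
    oddTerm f M * power w E
      ≡⟨ cong (_* power w E) rel ⟩
    f (suc (M ℕ.+ M)) * power w E
      ≡⟨ shift² (suc (M ℕ.+ M)) ⟨
    f (8 ℕ.+ (8 ℕ.+ suc (M ℕ.+ M)))
      ≡⟨ cong f (index m) ⟩
    f (suc ((8 ℕ.+ M) ℕ.+ (8 ℕ.+ M)))
      ∎
    where
    open ≡-Reasoning
    M = suc m
    E = 8 ℕ.+ (suc (M ℕ.+ M) ℕ.+ (8 ℕ.+ suc (M ℕ.+ M)))
    weight₁ : ∀ m → (8 ℕ.+ ((suc m ℕ.+ 2) ℕ.+ suc m)) ℕ.+ (8 ℕ.+ (suc m ℕ.+ suc m))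
                    ≡ 8 ℕ.+ (suc (suc m ℕ.+ suc m) ℕ.+ (8 ℕ.+ suc (suc m ℕ.+ suc m)))
    weight₁ = ℕ-solve
    weight₂ : ∀ m → (8 ℕ.+ (m ℕ.+ (suc m ℕ.+ 1))) ℕ.+ (8 ℕ.+ ((suc m ℕ.+ 1) ℕ.+ (suc m ℕ.+ 1)))
                    ≡ 8 ℕ.+ (suc (suc m ℕ.+ suc m) ℕ.+ (8 ℕ.+ suc (suc m ℕ.+ suc m)))
    weight₂ = ℕ-solve
    index : ∀ m → 8 ℕ.+ (8 ℕ.+ suc (suc m ℕ.+ suc m)) ≡ suc ((8 ℕ.+ suc m) ℕ.+ (8 ℕ.+ suc m))
    index = ℕ-solve

  mult-quartic : ∀ a b c → μ a * (μ b * μ c ^ 2) ≡ power w ((8 ℕ.+ (a ℕ.+ b)) ℕ.+ (8 ℕ.+ (c ℕ.+ c)))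
  mult-quartic a b c = begin
    μ a * (μ b * μ c ^ 2)      ≡⟨ pairs (μ a) (μ b) (μ c) ⟩
    (μ a * μ b) * (μ c * μ c)  ≡⟨ cong₂ _*_ (mult-pair w a b) (mult-pair w c c) ⟩
    power w (8 ℕ.+ (a ℕ.+ b)) * power w (8 ℕ.+ (c ℕ.+ c)) ≡⟨ power-+ w (8 ℕ.+ (a ℕ.+ b)) (8 ℕ.+ (c ℕ.+ c)) ⟨
    power w ((8 ℕ.+ (a ℕ.+ b)) ℕ.+ (8 ℕ.+ (c ℕ.+ c))) ∎
    where
    open ≡-Reasoning
    pairs : ∀ x y z → x * (y * (z * (z * + 1))) ≡ (x * y) * (z * z)
    pairs = ℤ-solve

  -- Likewise for the even relation, with m ≥ 2 for the index m ∸ 2.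
  even-shift : ∀ m → EvenRel f (suc (suc m)) → EvenRel f (8 ℕ.+ suc (suc m))
  even-shift m rel = begin
    evenTerm f (8 ℕ.+ M)
      ≡⟨ cong₂ (λ p q → p * q) (shift M)
           (cong₂ _-_ (cong₂ (λ p q → p * q ^ 2) (shift (M ℕ.+ 2)) (shift (suc m)))
                      (cong₂ (λ p q → p * q ^ 2) (shift m) (shift (M ℕ.+ 1)))) ⟩
    (f M * μ M) * ((f (M ℕ.+ 2) * μ (M ℕ.+ 2)) * (f (suc m) * μ (suc m)) ^ 2
                   - (f m * μ m) * (f (M ℕ.+ 1) * μ (M ℕ.+ 1)) ^ 2)
      ≡⟨ scale-even (f M) (f (M ℕ.+ 2)) (f (suc m)) (f m) (f (M ℕ.+ 1))
                    (μ M) (μ (M ℕ.+ 2)) (μ (suc m)) (μ m) (μ (M ℕ.+ 1)) (power w E)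
           (trans (mult-quartic M (M ℕ.+ 2) (suc m)) (cong (power w) (weight₁ m)))
           (trans (mult-quartic M m (M ℕ.+ 1)) (cong (power w) (weight₂ m))) ⟩
    evenTerm f M * power w E
      ≡⟨ cong (_* power w E) rel ⟩
    f (M ℕ.+ M) * f 2 * power w E
      ≡⟨ swap (f (M ℕ.+ M)) (f 2) (power w E) ⟩
    f (M ℕ.+ M) * power w E * f 2
      ≡⟨ cong (_* f 2) (shift² (M ℕ.+ M)) ⟨
    f (8 ℕ.+ (8 ℕ.+ (M ℕ.+ M))) * f 2
      ≡⟨ cong (λ n → f n * f 2) (index m) ⟩
    f ((8 ℕ.+ M) ℕ.+ (8 ℕ.+ M)) * f 2
      ∎
    where
    open ≡-Reasoning
    M = suc (suc m)
    E = 8 ℕ.+ ((M ℕ.+ M) ℕ.+ (8 ℕ.+ (M ℕ.+ M)))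
    swap : ∀ x y z → x * y * z ≡ x * z * y
    swap = ℤ-solve
    weight₁ : ∀ m → (8 ℕ.+ (suc (suc m) ℕ.+ (suc (suc m) ℕ.+ 2))) ℕ.+ (8 ℕ.+ (suc m ℕ.+ suc m))
                    ≡ 8 ℕ.+ ((suc (suc m) ℕ.+ suc (suc m)) ℕ.+ (8 ℕ.+ (suc (suc m) ℕ.+ suc (suc m))))
    weight₁ = ℕ-solve
    weight₂ : ∀ m → (8 ℕ.+ (suc (suc m) ℕ.+ m)) ℕ.+ (8 ℕ.+ ((suc (suc m) ℕ.+ 1) ℕ.+ (suc (suc m) ℕ.+ 1)))
                    ≡ 8 ℕ.+ ((suc (suc m) ℕ.+ suc (suc m)) ℕ.+ (8 ℕ.+ (suc (suc m) ℕ.+ suc (suc m))))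
    weight₂ = ℕ-solve
    index : ∀ m → 8 ℕ.+ (8 ℕ.+ (suc (suc m) ℕ.+ suc (suc m))) ≡ (8 ℕ.+ suc (suc m)) ℕ.+ (8 ℕ.+ suc (suc m))
    index = ℕ-solve

  odd-everywhere : (∀ m → m ℕ.< 8 → OddRel f (suc m)) → ∀ m → OddRel f (suc m)
  odd-everywhere = periodic-induction 8 odd-shift

  even-everywhere : (∀ m → m ℕ.< 8 → EvenRel f (2 ℕ.+ m)) → ∀ m → EvenRel f (2 ℕ.+ m)
  even-everywhere = periodic-induction 8 even-shift

  shift³ : ∀ n → f (24 ℕ.+ n) ≡ f n * (μ (8 ℕ.+ n) * μ (8 ℕ.+ n) * μ (8 ℕ.+ n))
  shift³ n = begin
    f (8 ℕ.+ (8 ℕ.+ (8 ℕ.+ n)))              ≡⟨ shift² (8 ℕ.+ n) ⟩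
    f (8 ℕ.+ n) * power w e₁                     ≡⟨ cong (_* power w e₁) (shift n) ⟩
    f n * μ n * power w e₁                       ≡⟨ ℤP.*-assoc (f n) (μ n) (power w e₁) ⟩
    f n * (μ n * power w e₁)                     ≡⟨ cong (f n *_) (trans (mult-power w n e₁) (cong (λ e → - power w e) (exponents n))) ⟩
    f n * - power w ((4 ℕ.+ (8 ℕ.+ n)) ℕ.+ e₂) ≡⟨ cong (f n *_) (mult-power w (8 ℕ.+ n) e₂) ⟨
    f n * (μ (8 ℕ.+ n) * power w e₂)             ≡⟨ cong (λ x → f n * (μ (8 ℕ.+ n) * x)) (mult-pair w (8 ℕ.+ n) (8 ℕ.+ n)) ⟨
    f n * (μ (8 ℕ.+ n) * (μ (8 ℕ.+ n) * μ (8 ℕ.+ n))) ≡⟨ cong (f n *_) (ℤP.*-assoc (μ (8 ℕ.+ n)) (μ (8 ℕ.+ n)) (μ (8 ℕ.+ n))) ⟨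
    f n * (μ (8 ℕ.+ n) * μ (8 ℕ.+ n) * μ (8 ℕ.+ n)) ∎
    where
    open ≡-Reasoning
    e₁ = 8 ℕ.+ ((8 ℕ.+ n) ℕ.+ (8 ℕ.+ (8 ℕ.+ n)))
    e₂ = 8 ℕ.+ ((8 ℕ.+ n) ℕ.+ (8 ℕ.+ n))
    exponents : ∀ n → (4 ℕ.+ n) ℕ.+ (8 ℕ.+ ((8 ℕ.+ n) ℕ.+ (8 ℕ.+ (8 ℕ.+ n))))
                      ≡ (4 ℕ.+ (8 ℕ.+ n)) ℕ.+ (8 ℕ.+ ((8 ℕ.+ n) ℕ.+ (8 ℕ.+ n)))
    exponents = ℕ-solve

  IsCube-periodic : w ≢ + 0 → ∀ n → IsCube (f n) ⇔ IsCube (f (n % 24))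
  IsCube-periodic w≢0 = periodic-induction 24 step base
    where
    step : ∀ m → IsCube (f m) ⇔ IsCube (f (m % 24)) → IsCube (f (24 ℕ.+ m)) ⇔ IsCube (f ((24 ℕ.+ m) % 24))
    step m cube-m = subst (λ r → IsCube (f (24 ℕ.+ m)) ⇔ IsCube (f r)) (sym residue)
      (cube-m ⇔-∘ subst (λ x → IsCube x ⇔ IsCube (f m)) (sym (shift³ m)) (IsCube-scale (μ (8 ℕ.+ m)) (mult≢0 (8 ℕ.+ m) w≢0)))
      where
      residue : (24 ℕ.+ m) % 24 ≡ m % 24
      residue = trans (cong (_% 24) (ℕP.+-comm 24 m)) (ℕD.[m+n]%n≡m%n m 24)
    base : ∀ r → r ℕ.< 24 → IsCube (f r) ⇔ IsCube (f (r % 24))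
    base r r<24 = subst (λ s → IsCube (f r) ⇔ IsCube (f s)) (sym (ℕD.m<n⇒m%n≡m r<24)) (⇔-id _)

-- Signed monomials ± αᵃ (α − 1)ᵇ (2α − 1)ᶜ in the three factors of h₂.
record Mono : Set where
  constructor mono
  field
    negative : Bool
    a b c    : ℕ

infixl 7 _⊕_
_⊕_ : Mono → Mono → Mono
mono s a b c ⊕ mono s' a' b' c' = mono (s xor s') (a ℕ.+ a') (b ℕ.+ b') (c ℕ.+ c')

unit : Mono
unit = mono false 0 0 0

infixr 8 _⊙_
_⊙_ : ℕ → Mono → Mono
zero  ⊙ m = unit
suc k ⊙ m = m ⊕ k ⊙ m

negate : Mono → Mono
negate (mono s a b c) = mono (not s) a b c

-- Monomials or zero: the values of the closed form of h.
Term : Set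
Term = Maybe Mono

infixl 7 _⊗_
_⊗_ : Term → Term → Term
just m ⊗ just n = just (m ⊕ n)
_      ⊗ _      = nothing

-- Product of a list, without a trailing factor 1, so that small monomials
-- evaluate to readable expressions such as α * α.
prod : List ℤ → ℤ
prod []           = + 1
prod (x ∷ [])     = x
prod (x ∷ y ∷ xs) = x * prod (y ∷ xs)

prod-++ : ∀ xs ys → prod (xs ++ ys) ≡ prod xs * prod ys
prod-++ []           ys       = sym (ℤP.*-identityˡ (prod ys))
prod-++ (x ∷ [])     []       = sym (ℤP.*-identityʳ x)
prod-++ (x ∷ [])     (y ∷ ys) = refl
prod-++ (x ∷ y ∷ xs) ys       = trans (cong (x *_) (prod-++ (y ∷ xs) ys)) (sym (ℤP.*-assoc x (prod (y ∷ xs)) (prod ys)))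

prod-replicate : ∀ n x → prod (replicate n x) ≡ x ^ n
prod-replicate zero          x = refl
prod-replicate (suc zero)    x = sym (ℤP.*-identityʳ x)
prod-replicate (suc (suc n)) x = cong (x *_) (prod-replicate (suc n) x)

signed : Bool → ℤ → ℤ
signed false x = x
signed true  x = - x

signed-* : ∀ s t x y → signed (s xor t) (x * y) ≡ signed s x * signed t y
signed-* false false x y = refl
signed-* false true  x y = ℤP.neg-distribʳ-* x y
signed-* true  false x y = ℤP.neg-distribˡ-* x y
signed-* true  true  x y = neg-neg x y
  where
  neg-neg : ∀ x y → x * y ≡ - x * - y
  neg-neg = ℤ-solve

signed-not : ∀ s x → signed (not s) x ≡ - signed s x
signed-not false x = refl
signed-not true  x = sym (ℤP.neg-involutive x)

signed≢0 : ∀ s {x} → x ≢ + 0 → signed s x ≢ + 0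
signed≢0 false x≢0 = x≢0
signed≢0 true  x≢0 = x≢0 ∘ ℤP.neg-injective

powT : ℕ → Term → Term
powT zero    x = just unit
powT (suc k) x = x ⊗ powT k x

-- Greatest common monomial factor of terms (zero is divisible by anything),
-- carrying the sign of the first nonzero term, and exact division by it.
gcdM : Mono → Mono → Mono
gcdM (mono s a b c) (mono _ a' b' c') = mono s (a ℕ.⊓ a') (b ℕ.⊓ b') (c ℕ.⊓ c')

gcdT : Term → Term → Term
gcdT nothing  y        = y
gcdT (just m) nothing  = just m
gcdT (just m) (just n) = just (gcdM m n)

common : Term → Term → Term → Mono
common P Q R = fromMaybe unit (gcdT P (gcdT Q R))

infixl 7 _÷_
_÷_ : Term → Mono → Term
nothing            ÷ _              = nothing
just (mono s a b c) ÷ mono s' a' b' c' = just (mono (s xor s') (a ℕ.∸ a') (b ℕ.∸ b') (c ℕ.∸ c'))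

-- Every monomial is a cube times a monomial with exponents below 3; the
-- sign goes into the cube since −1 = (−1)³.
cubeRoot : Mono → Mono
cubeRoot (mono s a b c) = mono s (a ℕ./ 3) (b ℕ./ 3) (c ℕ./ 3)

cubeFree : Mono → Mono
cubeFree (mono _ a b c) = mono false (a % 3) (b % 3) (c % 3)

cube-decomposition : ∀ M → M ≡ 3 ⊙ cubeRoot M ⊕ cubeFree M
cube-decomposition (mono s a b c) = mono-≡ (sign-cubed s) (split a) (split b) (split c)
  where
  mono-≡ : ∀ {s s' a a' b b' c c'} → s ≡ s' → a ≡ a' → b ≡ b' → c ≡ c' → mono s a b c ≡ mono s' a' b' c'
  mono-≡ refl refl refl refl = refl
  sign-cubed : ∀ s → s ≡ (s xor (s xor (s xor false))) xor false
  sign-cubed false = refl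
  sign-cubed true  = refl
  regroup : ∀ q r → r ℕ.+ q ℕ.* 3 ≡ (q ℕ.+ (q ℕ.+ (q ℕ.+ 0))) ℕ.+ r
  regroup = ℕ-solve
  split : ∀ a → a ≡ (a ℕ./ 3 ℕ.+ (a ℕ./ 3 ℕ.+ (a ℕ./ 3 ℕ.+ 0))) ℕ.+ a % 3
  split a = trans (ℕD.m≡m%n+[m/n]*n a 3) (regroup (a ℕ./ 3) (a % 3))

module Evaluation (α : ℤ) where

  factors : Mono → List ℤ
  factors (mono _ a b c) = replicate a α ++ replicate b (α - + 1) ++ replicate c (+ 2 * α - + 1)

  ev : Mono → ℤ
  ev m = signed (Mono.negative m) (prod (factors m))

  evT : Term → ℤ
  evT nothing  = + 0
  evT (just m) = ev m

  ev-powers : ∀ s a b c → ev (mono s a b c) ≡ signed s (α ^ a * ((α - + 1) ^ b * (+ 2 * α - + 1) ^ c))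
  ev-powers s a b c = cong (signed s) (begin
    prod (A ++ B ++ C)               ≡⟨ prod-++ A (B ++ C) ⟩
    prod A * prod (B ++ C)           ≡⟨ cong (prod A *_) (prod-++ B C) ⟩
    prod A * (prod B * prod C)       ≡⟨ cong₂ _*_ (prod-replicate a α) (cong₂ _*_ (prod-replicate b (α - + 1)) (prod-replicate c (+ 2 * α - + 1))) ⟩
    α ^ a * ((α - + 1) ^ b * (+ 2 * α - + 1) ^ c) ∎)
    where
    open ≡-Reasoning
    A = replicate a α
    B = replicate b (α - + 1)
    C = replicate c (+ 2 * α - + 1)

  ev-⊕ : ∀ m n → ev (m ⊕ n) ≡ ev m * ev n
  ev-⊕ (mono s a b c) (mono s' a' b' c') = begin
    ev (mono (s xor s') (a ℕ.+ a') (b ℕ.+ b') (c ℕ.+ c'))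
      ≡⟨ ev-powers (s xor s') (a ℕ.+ a') (b ℕ.+ b') (c ℕ.+ c') ⟩
    signed (s xor s') (X ^ (a ℕ.+ a') * (Y ^ (b ℕ.+ b') * Z ^ (c ℕ.+ c')))
      ≡⟨ cong (signed (s xor s')) (cong₂ _*_ (ℤP.^-distribˡ-+-* X a a') (cong₂ _*_ (ℤP.^-distribˡ-+-* Y b b') (ℤP.^-distribˡ-+-* Z c c'))) ⟩
    signed (s xor s') (X ^ a * X ^ a' * (Y ^ b * Y ^ b' * (Z ^ c * Z ^ c')))
      ≡⟨ cong (signed (s xor s')) (regroup (X ^ a) (X ^ a') (Y ^ b) (Y ^ b') (Z ^ c) (Z ^ c')) ⟩
    signed (s xor s') (X ^ a * (Y ^ b * Z ^ c) * (X ^ a' * (Y ^ b' * Z ^ c')))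
      ≡⟨ signed-* s s' _ _ ⟩
    signed s (X ^ a * (Y ^ b * Z ^ c)) * signed s' (X ^ a' * (Y ^ b' * Z ^ c'))
      ≡⟨ cong₂ _*_ (ev-powers s a b c) (ev-powers s' a' b' c') ⟨
    ev (mono s a b c) * ev (mono s' a' b' c') ∎
    where
    open ≡-Reasoning
    X = α
    Y = α - + 1
    Z = + 2 * α - + 1
    regroup : ∀ x x' y y' z z' → x * x' * (y * y' * (z * z')) ≡ x * (y * z) * (x' * (y' * z'))
    regroup = ℤ-solve

  ev-⊙ : ∀ k m → ev (k ⊙ m) ≡ ev m ^ k
  ev-⊙ zero    m = refl
  ev-⊙ (suc k) m = trans (ev-⊕ m (k ⊙ m)) (cong (ev m *_) (ev-⊙ k m))

  ev-negate : ∀ m → ev (negate m) ≡ - ev m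
  ev-negate (mono s a b c) = signed-not s _

  evT-⊗ : ∀ x y → evT (x ⊗ y) ≡ evT x * evT y
  evT-⊗ nothing  y        = refl
  evT-⊗ (just m) nothing  = sym (ℤP.*-zeroʳ (ev m))
  evT-⊗ (just m) (just n) = ev-⊕ m n

  evT-pow : ∀ k x → evT (powT k x) ≡ evT x ^ k
  evT-pow zero    x = refl
  evT-pow (suc k) x = trans (evT-⊗ x (powT k x)) (cong (evT x *_) (evT-pow k x))

  -- An identity P − Q = R between terms is checked by dividing all three by
  -- their common monomial factor G (three computations) and verifying the
  -- remaining small polynomial identity in α.
  Reduced : Term → Term → Term → Set
  Reduced P Q R = (P ≡ just G ⊗ (P ÷ G)) × (Q ≡ just G ⊗ (Q ÷ G)) × (R ≡ just G ⊗ (R ÷ G))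
                × (evT (P ÷ G) - evT (Q ÷ G) ≡ evT (R ÷ G))
    where G = common P Q R

  factor-out : ∀ P Q R → Reduced P Q R → evT P - evT Q ≡ evT R
  factor-out P Q R (P≡ , Q≡ , R≡ , reduced) = begin
    evT P - evT Q                       ≡⟨ cong₂ _-_ (split P≡) (split Q≡) ⟩
    g * evT (P ÷ G) - g * evT (Q ÷ G)   ≡⟨ distrib g (evT (P ÷ G)) (evT (Q ÷ G)) ⟨
    g * (evT (P ÷ G) - evT (Q ÷ G))     ≡⟨ cong (g *_) reduced ⟩
    g * evT (R ÷ G)                     ≡⟨ split R≡ ⟨
    evT R                               ∎
    where
    open ≡-Reasoning
    G = common P Q R
    g = ev G
    split : ∀ {X} → X ≡ just G ⊗ (X ÷ G) → evT X ≡ g * evT (X ÷ G)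
    split {X} X≡ = trans (cong evT X≡) (evT-⊗ (just G) (X ÷ G))
    distrib : ∀ p q r → p * (q - r) ≡ p * q - p * r
    distrib = ℤ-solve

  odd-check : ∀ T m →
    Reduced (T (m ℕ.+ 2) ⊗ powT 3 (T m)) (T (m ℕ.∸ 1) ⊗ powT 3 (T (m ℕ.+ 1))) (T (suc (m ℕ.+ m))) →
    OddRel (evT ∘ T) m
  odd-check T m reduced =
    trans (cong₂ _-_ (product (T (m ℕ.+ 2)) (T m)) (product (T (m ℕ.∸ 1)) (T (m ℕ.+ 1)))) (factor-out _ _ _ reduced)
    where
    product : ∀ x y → evT x * evT y ^ 3 ≡ evT (x ⊗ powT 3 y)
    product x y = sym (trans (evT-⊗ x (powT 3 y)) (cong (evT x *_) (evT-pow 3 y)))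

  even-check : ∀ T m →
    Reduced (T m ⊗ T (m ℕ.+ 2) ⊗ powT 2 (T (m ℕ.∸ 1))) (T m ⊗ T (m ℕ.∸ 2) ⊗ powT 2 (T (m ℕ.+ 1))) (T (m ℕ.+ m) ⊗ T 2) →
    EvenRel (evT ∘ T) m
  even-check T m reduced = begin
    evenTerm (evT ∘ T) m
      ≡⟨ distrib (evT (T m)) (evT (T (m ℕ.+ 2)) * evT (T (m ℕ.∸ 1)) ^ 2) (evT (T (m ℕ.∸ 2)) * evT (T (m ℕ.+ 1)) ^ 2) ⟩
    evT (T m) * (evT (T (m ℕ.+ 2)) * evT (T (m ℕ.∸ 1)) ^ 2) - evT (T m) * (evT (T (m ℕ.∸ 2)) * evT (T (m ℕ.+ 1)) ^ 2)
      ≡⟨ cong₂ _-_ (product (T m) (T (m ℕ.+ 2)) (T (m ℕ.∸ 1))) (product (T m) (T (m ℕ.∸ 2)) (T (m ℕ.+ 1))) ⟩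
    evT (T m ⊗ T (m ℕ.+ 2) ⊗ powT 2 (T (m ℕ.∸ 1))) - evT (T m ⊗ T (m ℕ.∸ 2) ⊗ powT 2 (T (m ℕ.+ 1)))
      ≡⟨ factor-out _ _ _ reduced ⟩
    evT (T (m ℕ.+ m) ⊗ T 2)
      ≡⟨ evT-⊗ (T (m ℕ.+ m)) (T 2) ⟩
    evT (T (m ℕ.+ m)) * evT (T 2) ∎
    where
    open ≡-Reasoning
    distrib : ∀ p q r → p * (q - r) ≡ p * q - p * r
    distrib = ℤ-solve
    product : ∀ x y z → evT x * (evT y * evT z ^ 2) ≡ evT (x ⊗ y ⊗ powT 2 z)
    product x y z = sym (begin
      evT (x ⊗ y ⊗ powT 2 z)           ≡⟨ evT-⊗ (x ⊗ y) (powT 2 z) ⟩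
      evT (x ⊗ y) * evT (powT 2 z)     ≡⟨ cong₂ _*_ (evT-⊗ x y) (evT-pow 2 z) ⟩
      evT x * evT y * evT z ^ 2        ≡⟨ ℤP.*-assoc (evT x) (evT y) (evT z ^ 2) ⟩
      evT x * (evT y * evT z ^ 2)      ∎)

  module NonDegenerate (α≢0 : α ≢ + 0) (α≢1 : α ≢ + 1) where

    α-1≢0 : α - + 1 ≢ + 0
    α-1≢0 = α≢1 ∘ ℤP.i-j≡0⇒i≡j α (+ 1)

    2α-1≢0 : + 2 * α - + 1 ≢ + 0
    2α-1≢0 eq with ℕP.m*n≡1⇒m≡1 2 ∣ α ∣ (trans (sym (ℤP.abs-* (+ 2) α)) (cong ∣_∣ (ℤP.i-j≡0⇒i≡j (+ 2 * α) (+ 1) eq)))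
    ... | ()

    ev≢0 : ∀ m → ev m ≢ + 0
    ev≢0 (mono s a b c) = subst (_≢ + 0) (sym (ev-powers s a b c))
      (signed≢0 s (*-≢0 (^-≢0 a α≢0) (*-≢0 (^-≢0 b α-1≢0) (^-≢0 c 2α-1≢0))))
      where
      ^-≢0 : ∀ {x} k → x ≢ + 0 → x ^ k ≢ + 0
      ^-≢0 {x} k x≢0 = x≢0 ∘ ℤP.i^n≡0⇒i≡0 x k

    IsCube-monomial : ∀ M → IsCube (ev M) ⇔ IsCube (ev (cubeFree M))
    IsCube-monomial M = subst (λ x → IsCube x ⇔ IsCube (ev (cubeFree M))) (sym ev-M) (IsCube-scale β (ev≢0 (cubeRoot M)))
      where
      β = ev (cubeRoot M)
      ev-M : ev M ≡ ev (cubeFree M) * (β * β * β)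
      ev-M = begin
        ev M                                     ≡⟨ cong ev (cube-decomposition M) ⟩
        ev (3 ⊙ cubeRoot M ⊕ cubeFree M)         ≡⟨ ev-⊕ (3 ⊙ cubeRoot M) (cubeFree M) ⟩
        ev (3 ⊙ cubeRoot M) * ev (cubeFree M)    ≡⟨ cong (_* ev (cubeFree M)) (ev-⊙ 3 (cubeRoot M)) ⟩
        β ^ 3 * ev (cubeFree M)                  ≡⟨ swap β (ev (cubeFree M)) ⟩
        ev (cubeFree M) * (β * β * β)            ∎
        where
        open ≡-Reasoning
        swap : ∀ b q → b * (b * (b * + 1)) * q ≡ q * (b * b * b)
        swap = ℤ-solve

module ClosedForm (α : ℤ) where
  open Evaluation α

  wMono : Mono
  wMono = mono true 15 7 6

  w : ℤ
  w = ev wMono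

  multMono : ℕ → Mono
  multMono n = negate ((4 ℕ.+ n) ⊙ wMono)

  closedTerm : ℕ → Term
  closedTerm 0 = nothing
  closedTerm 1 = just (mono false  0  0  0)
  closedTerm 2 = just (mono true   3  1  1)
  closedTerm 3 = just (mono true   8  3  3)
  closedTerm 4 = just (mono false 14  6  6)
  closedTerm 5 = just (mono false 23 10  9)
  closedTerm 6 = just (mono true  33 15 13)
  closedTerm 7 = just (mono true  45 21 18)
  closedTerm (suc (suc (suc (suc (suc (suc (suc (suc n)))))))) = closedTerm n ⊗ just (multMono n)

  closed : ℕ → ℤ
  closed n = evT (closedTerm n)

  closed-shift : ∀ n → closed (8 ℕ.+ n) ≡ closed n * mult w n
  closed-shift n = begin
    evT (closedTerm n ⊗ just (multMono n))   ≡⟨ evT-⊗ (closedTerm n) (just (multMono n)) ⟩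
    closed n * ev (multMono n)               ≡⟨ cong (closed n *_) (ev-negate ((4 ℕ.+ n) ⊙ wMono)) ⟩
    closed n * - ev ((4 ℕ.+ n) ⊙ wMono)      ≡⟨ cong (λ x → closed n * - x) (ev-⊙ (4 ℕ.+ n) wMono) ⟩
    closed n * - (w ^ (4 ℕ.+ n))             ≡⟨ cong (closed n *_) (mult-def w n) ⟨
    closed n * mult w n                      ∎
    where open ≡-Reasoning

  -- After dividing out common monomials, the base cases of the recurrences
  -- come down to the relations 2α − 1 = α + (α − 1) and
  -- α² = (α − 1)² + (2α − 1) between the three factors.
  linear : ∀ x → (+ 2 * x - + 1) - x ≡ x - + 1
  linear = ℤ-solve

  quadratic : ∀ x → x * x - (+ 2 * x - + 1) ≡ (x - + 1) * (x - + 1)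
  quadratic = ℤ-solve

  open QuasiPeriodic w closed closed-shift

  odd-base : ∀ m → m ℕ.< 8 → OddRel closed (suc m)
  odd-base 0 _ = odd-check closedTerm 1 (refl , refl , refl , refl)
  odd-base 1 _ = odd-check closedTerm 2 (refl , refl , refl , flip-sides α (+ 1) refl)
  odd-base 2 _ = odd-check closedTerm 3 (refl , refl , refl , quadratic α)
  odd-base 3 _ = odd-check closedTerm 4 (refl , refl , refl , flip-sides (α * α) (+ 2 * α - + 1) (quadratic α))
  odd-base 4 _ = odd-check closedTerm 5 (refl , refl , refl , refl)
  odd-base 5 _ = odd-check closedTerm 6 (refl , refl , refl , refl)
  odd-base 6 _ = odd-check closedTerm 7 (refl , refl , refl , refl)
  odd-base 7 _ = odd-check closedTerm 8 (refl , refl , refl , refl)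
  odd-base (suc (suc (suc (suc (suc (suc (suc (suc _)))))))) (ℕ.s≤s (ℕ.s≤s (ℕ.s≤s (ℕ.s≤s (ℕ.s≤s (ℕ.s≤s (ℕ.s≤s (ℕ.s≤s ()))))))))

  even-base : ∀ m → m ℕ.< 8 → EvenRel closed (2 ℕ.+ m)
  even-base 0 _ = even-check closedTerm 2 (refl , refl , refl , refl)
  even-base 1 _ = even-check closedTerm 3 (refl , refl , refl , flip-sides (+ 2 * α - + 1) α (linear α))
  even-base 2 _ = even-check closedTerm 4 (refl , refl , refl , refl)
  even-base 3 _ = even-check closedTerm 5 (refl , refl , refl , linear α)
  even-base 4 _ = even-check closedTerm 6 (refl , refl , refl , refl)
  even-base 5 _ = even-check closedTerm 7 (refl , refl , refl , refl)
  even-base 6 _ = even-check closedTerm 8 (refl , refl , refl , refl)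
  even-base 7 _ = even-check closedTerm 9 (refl , refl , refl , refl)
  even-base (suc (suc (suc (suc (suc (suc (suc (suc _)))))))) (ℕ.s≤s (ℕ.s≤s (ℕ.s≤s (ℕ.s≤s (ℕ.s≤s (ℕ.s≤s (ℕ.s≤s (ℕ.s≤s ()))))))))

  initial : ∀ n → n ℕ.< 5 → h α n ≡ closed n
  initial 0 _ = refl
  initial 1 _ = refl
  initial 2 _ = trans (cong -_ (trans (ℤP.*-assoc (α ^ 3) (α - + 1) (+ 2 * α - + 1))
                        (cong (α ^ 3 *_) (cong₂ _*_ (sym (ℤP.^-identityʳ (α - + 1))) (sym (ℤP.^-identityʳ (+ 2 * α - + 1)))))))
                      (sym (ev-powers true 3 1 1))
  initial 3 _ = trans (cong -_ (ℤP.*-assoc (α ^ 8) ((α - + 1) ^ 3) ((+ 2 * α - + 1) ^ 3))) (sym (ev-powers true 8 3 3))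
  initial 4 _ = trans (ℤP.*-assoc (α ^ 14) ((α - + 1) ^ 6) ((+ 2 * α - + 1) ^ 6)) (sym (ev-powers false 14 6 6))
  initial (suc (suc (suc (suc (suc _))))) (ℕ.s≤s (ℕ.s≤s (ℕ.s≤s (ℕ.s≤s (ℕ.s≤s ())))))

  module _ (α≢0 : α ≢ + 0) (α≢1 : α ≢ + 1) where
    open NonDegenerate α≢0 α≢1

    h≡closed : ∀ n → h α n ≡ closed n
    h≡closed = h-unique α closed initial odd even h₂≢0
      where
      odd : ∀ m → 2 ℕ.≤ m → OddRel closed m
      odd (suc m) _ = odd-everywhere odd-base m
      even : ∀ m → 3 ℕ.≤ m → EvenRel closed m
      even (suc (suc m)) _ = even-everywhere even-base m
      even 1 (ℕ.s≤s ())
      h₂≢0 : h₂ α ≢ + 0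
      h₂≢0 = subst (_≢ + 0) (sym (initial 2 (ℕ.s≤s (ℕ.s≤s (ℕ.s≤s ℕ.z≤n))))) (ev≢0 (mono true 3 1 1))

    cube-class : ∀ n {r M} → n % 24 ≡ r → closedTerm r ≡ just M → IsCube (h α n) ⇔ IsCube (ev (cubeFree M))
    cube-class n {M = M} refl closedTerm≡ = IsCube-monomial M ⇔-∘ residue-class
      where
      residue-class : IsCube (h α n) ⇔ IsCube (ev M)
      residue-class = subst (λ t → IsCube (h α n) ⇔ IsCube (evT t)) closedTerm≡
        (subst (λ x → IsCube x ⇔ IsCube (closed (n % 24))) (sym (h≡closed n)) (IsCube-periodic (ev≢0 wMono) n))

theorem5p13 : (α : ℤ) → α ≢ + 0 → α ≢ + 1 → (n : ℕ) →
    ((n % 24 ≡ 1 ⊎ n % 24 ≡ 7 ⊎ n % 24 ≡ 17 ⊎ n % 24 ≡ 23) → IsCube (h α n))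
    × ((n % 24 ≡ 3 ⊎ n % 24 ≡ 4 ⊎ n % 24 ≡ 20 ⊎ n % 24 ≡ 21) → (IsCube (h α n) ⇔ IsCube α))
    × ((n % 24 ≡ 6 ⊎ n % 24 ≡ 18) → (IsCube (h α n) ⇔ IsCube (+ 2 * α - + 1)))
    × ((n % 24 ≡ 9 ⊎ n % 24 ≡ 15) → (IsCube (h α n) ⇔ IsCube (α - + 1)))
theorem5p13 α α≢0 α≢1 n = always , iff-α , iff-2α-1 , iff-α-1
  where
  open Evaluation α
  open ClosedForm α
  -- For each residue r, closed r is a cube times 1, α², 2α − 1 or (α − 1)².
  class : ∀ {r M} → n % 24 ≡ r → closedTerm r ≡ just M → IsCube (h α n) ⇔ IsCube (ev (cubeFree M))
  class = cube-class α≢0 α≢1 n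
  always : (n % 24 ≡ 1 ⊎ n % 24 ≡ 7 ⊎ n % 24 ≡ 17 ⊎ n % 24 ≡ 23) → IsCube (h α n)
  always (inj₁ r)               = Equivalence.from (class r refl) IsCube-one
  always (inj₂ (inj₁ r))        = Equivalence.from (class r refl) IsCube-one
  always (inj₂ (inj₂ (inj₁ r))) = Equivalence.from (class r refl) IsCube-one
  always (inj₂ (inj₂ (inj₂ r))) = Equivalence.from (class r refl) IsCube-one
  iff-α : (n % 24 ≡ 3 ⊎ n % 24 ≡ 4 ⊎ n % 24 ≡ 20 ⊎ n % 24 ≡ 21) → (IsCube (h α n) ⇔ IsCube α)
  iff-α (inj₁ r)               = IsCube-square ⇔-∘ class r refl
  iff-α (inj₂ (inj₁ r))        = IsCube-square ⇔-∘ class r refl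
  iff-α (inj₂ (inj₂ (inj₁ r))) = IsCube-square ⇔-∘ class r refl
  iff-α (inj₂ (inj₂ (inj₂ r))) = IsCube-square ⇔-∘ class r refl
  iff-2α-1 : (n % 24 ≡ 6 ⊎ n % 24 ≡ 18) → (IsCube (h α n) ⇔ IsCube (+ 2 * α - + 1))
  iff-2α-1 (inj₁ r) = class r refl
  iff-2α-1 (inj₂ r) = class r refl
  iff-α-1 : (n % 24 ≡ 9 ⊎ n % 24 ≡ 15) → (IsCube (h α n) ⇔ IsCube (α - + 1))
  iff-α-1 (inj₁ r) = IsCube-square ⇔-∘ class r refl
  iff-α-1 (inj₂ r) = IsCube-square ⇔-∘ class r refl
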